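{- For every $I=(i_1,\dots,i_p)$ with $p\ge1$ and $0<i_1<\dots<i_p$, the projection by $\tau_I$ of a totally primitive element is totally primitive, so that $\tau_I(\operatorname{TPrim})=\operatorname{Im}(\tau_I)\cap\operatorname{TPrim}$. Moreover, \[ \operatorname{TPrim} = \bigoplus_I \operatorname{Im}(\tau_I)\cap\operatorname{TPrim}, \] where $I$ ranges over all such finite strictly increasing non-empty sequences of positive integers.
   Context: A word over $\mathbb{N}_{>0}$ is packed if every letter from $1$ to its maximum appears at least once; $\mathbf{PW}_n$ is the set of packed words of length $n$. For a word $w$ whose distinct letters are $b_1<\dots<b_r$, $\mathrm{pack}(w)$ is the image of $w$ under $b_i\mapsto i$. $\mathbf{WQSym}$ is the vector space over a field $K$ with basis $(\mathbb{R}_w)$ indexed by packed words, and $\mathbf{WQSym}_+$ is the span of $\mathbb{R}_w$ for non-empty $w$. For $u=u_1\cdots u_n\in\mathbf{PW}_n$, $n\ge1$: $\Delta_\prec(\mathbb{R}_u)=\sum \mathbb{R}_{\mathrm{pack}(u_1\cdots u_i)}\otimes\mathbb{R}_{\mathrm{pack}(u_{i+1}\cdots u_n)}$ summed over $1\le i\le n-1$ with $\{u_1,\dots,u_i\}\cap\{u_{i+1},\dots,u_n\}=\emptyset$ and all occurrences of $\max(u)$ in positions $\le i$; $\Delta_\succ(\mathbb{R}_u)$ is the same sum over those $i$ with disjoint letter sets and all occurrences of $\max(u)$ in positions $>i$; both extended linearly to $\mathbf{WQSym}_+$. $\operatorname{TPrim}=\operatorname{Ker}\Delta_\prec\cap\operatorname{Ker}\Delta_\succ\subseteq\mathbf{WQSym}_+$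 (totally primitive elements). The linear projector $\tau_I$ is defined by $\tau_I(\mathbb{R}_w)=\mathbb{R}_w$ if for all positions $i$ one has $w_i=\max(w)\iff i\in I$, and $\tau_I(\mathbb{R}_w)=0$ otherwise. -}

module Defs where

open import Level using (Level; _⊔_; suc)
open import Algebra.Bundles using (CommutativeRing)
open import Data.Bool using (Bool; true; false; not; _∧_; if_then_else_)
open import Data.Nat as ℕ using (ℕ; zero; _∸_; _≡ᵇ_; _≤ᵇ_; _<_; _≤_)
open import Data.List using (List; []; _∷_; _++_; map; foldr; length; take; drop; upTo;
  filterᵇ; concatMap; deduplicateᵇ; zip)
open import Data.Bool.ListAction using (all; any)
open import Data.List.Properties using (≡-dec)
open import Data.List.Membership.Propositional using (_∈_)
open import Data.List.Relation.Unary.Linked using (Linked)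
open import Data.Product using (Σ; _×_; _,_; proj₁; proj₂)
open import Relation.Nullary using (¬_; does)
open import Relation.Binary.PropositionalEquality using (_≡_; _≢_)

record Field (c ℓ : Level) : Set (Level.suc (c ⊔ ℓ)) where
  field
    commutativeRing : CommutativeRing c ℓ
  open CommutativeRing commutativeRing public
  field
    0≉1     : ¬ (0# ≈ 1#)
    inverse : ∀ x → ¬ (x ≈ 0#) → Σ Carrier λ y → (x * y) ≈ 1#

-- Words over positive integers (letters are natural numbers ≥ 1).

Word : Set
Word = List ℕ

maxW : Word → ℕ
maxW = foldr ℕ._⊔_ 0

IsPacked : Word → Set
IsPacked w = (∀ a → a ∈ w → 1 ≤ a) × (∀ k → 1 ≤ k → k ≤ maxW w → k ∈ w)

NonEmpty : Word → Set
NonEmpty w = w ≢ []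

-- non-empty packed words: the basis of WQSym₊
PW⁺ : Set
PW⁺ = Σ Word λ w → IsPacked w × NonEmpty w

_==ᵂ_ : Word → Word → Bool
u ==ᵂ v = does (≡-dec ℕ._≟_ u v)

_∈ᵇ_ : ℕ → Word → Bool
a ∈ᵇ w = any (a ≡ᵇ_) w

-- pack(w): the letter a is sent to the number of distinct letters b ≤ a of w,
-- i.e. b_i ↦ i where b_1 < … < b_r are the distinct letters of w.
pack : Word → Word
pack w = map (λ a → length (filterᵇ (_≤ᵇ a) (deduplicateᵇ _≡ᵇ_ w))) w

-- the 1-based positions i with w_i = max(w), in increasing order
maxPositions : Word → List ℕ
maxPositions w = map proj₁ (filterᵇ (λ p → proj₂ p ≡ᵇ maxW w) (zip (map ℕ.suc (upTo (length w))) w))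

module WQSym {c ℓ : Level} (K : Field c ℓ) where
  open Field K

  -- an element of WQSym₊ is a finite formal linear combination Σ c_w ℝ_w
  -- of non-empty packed words
  WQ₊ : Set c
  WQ₊ = List (Carrier × PW⁺)

  -- an element of WQSym₊ ⊗ WQSym₊ : finite combination Σ c ℝ_u ⊗ ℝ_v
  WQ₊⊗WQ₊ : Set c
  WQ₊⊗WQ₊ = List (Carrier × Word × Word)

  coeff : WQ₊ → Word → Carrier
  coeff x w = foldr (λ t acc → (if proj₁ (proj₂ t) ==ᵂ w then proj₁ t else 0#) + acc) 0# x

  coeff₂ : WQ₊⊗WQ₊ → Word → Word → Carrier
  coeff₂ d u v = foldr (λ t acc →
    (if (proj₁ (proj₂ t) ==ᵂ u) ∧ (proj₂ (proj₂ t) ==ᵂ v) then proj₁ t else 0#) + acc) 0# d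

  _≋_ : WQ₊ → WQ₊ → Set ℓ
  x ≋ y = ∀ w → coeff x w ≈ coeff y w

  0ᵂ : WQ₊
  0ᵂ = []

  _+ᵂ_ : WQ₊ → WQ₊ → WQ₊
  _+ᵂ_ = _++_

  sumᵂ : List WQ₊ → WQ₊
  sumᵂ = foldr _+ᵂ_ 0ᵂ

  -- cut positions 1 ≤ i ≤ n-1 of u
  cuts : Word → List (Word × Word)
  cuts u = map (λ i → take i u , drop i u) (map ℕ.suc (upTo (length u ∸ 1)))

  disjointᵇ : Word → Word → Bool
  disjointᵇ l r = all (λ a → not (a ∈ᵇ r)) l

  Δ≺ : WQ₊ → WQ₊⊗WQ₊
  Δ≺ = concatMap λ t →
    let cf = proj₁ t ; u = proj₁ (proj₂ t) in
    map (λ lr → cf , pack (proj₁ lr) , pack (proj₂ lr))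
        (filterᵇ (λ lr → disjointᵇ (proj₁ lr) (proj₂ lr) ∧ not (maxW u ∈ᵇ proj₂ lr)) (cuts u))

  Δ≻ : WQ₊ → WQ₊⊗WQ₊
  Δ≻ = concatMap λ t →
    let cf = proj₁ t ; u = proj₁ (proj₂ t) in
    map (λ lr → cf , pack (proj₁ lr) , pack (proj₂ lr))
        (filterᵇ (λ lr → disjointᵇ (proj₁ lr) (proj₂ lr) ∧ not (maxW u ∈ᵇ proj₁ lr)) (cuts u))

  IsZero₂ : WQ₊⊗WQ₊ → Set ℓ
  IsZero₂ d = ∀ u v → coeff₂ d u v ≈ 0#

  TPrim : WQ₊ → Set ℓ
  TPrim x = IsZero₂ (Δ≺ x) × IsZero₂ (Δ≻ x)

  τ : List ℕ → WQ₊ → WQ₊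
  τ I = filterᵇ (λ t → maxPositions (proj₁ (proj₂ t)) ==ᵂ I)

  InIm : List ℕ → WQ₊ → Set (c ⊔ ℓ)
  InIm I y = Σ WQ₊ λ x → τ I x ≋ y

ValidIndex : List ℕ → Set
ValidIndex I = NonEmpty I × (∀ i → i ∈ I → 0 < i) × Linked _<_ I

-- A cut (l , r) of w contributing to Δ≺(ℝ_w) keeps every occurrence of max(w) in l, so the
-- positions of max(w) in w are those of max(pack l) in pack l; for Δ≻ they are those of
-- max(pack r) in pack r shifted by |l|.  Hence each tensor ℝ_u ⊗ ℝ_v occurring in a half-coproduct
-- of ℝ_w determines the set I of positions of max(w): the half-coproducts send the images of the
-- projectors τ_I into parts of the tensor square that are independent for distinct I, so their
-- kernels are stable under every τ_I.  Everything else is linear algebra of the orthogonal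
-- projectors τ_I, which add up to the identity.

module Submission where

open import Defs
open import Level using (Level)
open import Algebra.Bundles using (Semiring)
open import Function.Base using (_∘_; _∘₂_; id)
open import Function.Bundles using (_⇔_; mk⇔; Equivalence)
open import Data.Bool.Base using (Bool; true; false; T; not; _∧_; if_then_else_)
open import Data.Bool.Properties using (T-∧; T-not-≡)
open import Data.Nat.Base using (ℕ; _≡ᵇ_) renaming (_+_ to _ℕ+_)
import Data.Nat.Properties as ℕ
open import Data.Product using (Σ; ∃; _×_; _,_; proj₁; proj₂)
open import Data.List.Base
  using (List; []; _∷_; [_]; _++_; map; foldr; concatMap; length; applyUpTo; filterᵇ; zip; deduplicate; deduplicateᵇ)
open import Data.List.Properties
  using (≡-dec; length-map; take++drop≡id; map-∘; map-id; map-++; map-cong; ++-assoc; ++-identityʳ; foldr-map)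
open import Data.List.Relation.Unary.Any using (here; there)
import Data.List.Relation.Unary.Any as Any
open import Data.List.Relation.Unary.Any.Properties using (any⁺)
open import Data.List.Relation.Unary.All using (All)
import Data.List.Relation.Unary.All as All
import Data.List.Relation.Unary.All.Properties as Allₚ
open import Data.List.Relation.Unary.AllPairs using (_∷_)
open import Data.List.Relation.Unary.Unique.Propositional using (Unique)
open import Data.List.Relation.Unary.Unique.DecPropositional.Properties using (deduplicate-!)
open import Data.List.Membership.Propositional using (_∈_; _∉_)
open import Data.List.Membership.Propositional.Properties
  using (∈-filter⁻; ∈-map⁺; ∈-map⁻; ∈-++⁺ˡ; ∈-++⁺ʳ; ∈-deduplicate⁺; ∈-deduplicate⁻)
open import Relation.Nullary using (Dec; yes; no; proof; contradiction; ¬_)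
open import Relation.Nullary.Decidable using (T?)
open import Relation.Binary.Definitions using (DecidableEquality)
import Relation.Binary.PropositionalEquality as ≡
open ≡ using (_≡_; _≢_)

module MaxPositions where

  open import Data.Empty using (⊥-elim)
  open import Data.Sum using (inj₁; inj₂; [_,_]′)
  open import Data.Unit using (tt)
  open import Data.Nat.Base using (ℕ; zero; suc; _+_; _⊔_; _≡ᵇ_; _≤ᵇ_; _≤_; _<_; z≤n; s≤s; z<s; s<s)
  open import Data.Nat.Properties
    using (_≟_; _≤?_; ≡ᵇ⇒≡; ≡⇒≡ᵇ; ≤ᵇ⇒≤; ≤⇒≤ᵇ; ≤-trans; ≤-refl; m≤n⇒m≤1+n; <⇒≢; <⇒≱; <⇒≤; ≰⇒>; n≮0;
           m≤n⇒m<n∨m≡n; +-suc; ⊔-comm; ⊔-assoc; ⊔-sel; ⊔-identityʳ; m≤m⊔n; m≤n⊔m; m≥n⇒m⊔n≡m; m≤n⇒m⊔n≡n;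
           mono-≤-distrib-⊔)
  import Data.List.Membership.Setoid.Properties as SetoidMembership
  open import Data.List.Relation.Unary.Linked using (Linked; []; [-]; _∷_)
  import Data.List.Relation.Unary.Linked as Linked
  open import Data.List.Relation.Unary.Linked.Properties using (map⁺)
  open import Relation.Nullary.Reflects using (Reflects; ofʸ; ofⁿ; det; fromEquivalence)
  open ≡ using (refl; sym; cong; cong₂)
  open ≡.≡-Reasoning

  ≡ᵇ-reflects-≡ : ∀ m n → Reflects (m ≡ n) (m ≡ᵇ n)
  ≡ᵇ-reflects-≡ m n = proof (m ≟ n)

  maxW-++ : ∀ l r → maxW (l ++ r) ≡ maxW l ⊔ maxW r
  maxW-++ []      r = refl
  maxW-++ (a ∷ l) r = ≡.trans (cong (a ⊔_) (maxW-++ l r)) (sym (⊔-assoc a (maxW l) (maxW r)))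

  maxW-++-comm : ∀ l r → maxW (l ++ r) ≡ maxW (r ++ l)
  maxW-++-comm l r = begin
    maxW (l ++ r)     ≡⟨ maxW-++ l r ⟩
    maxW l ⊔ maxW r   ≡⟨ ⊔-comm (maxW l) (maxW r) ⟩
    maxW r ⊔ maxW l   ≡⟨ maxW-++ r l ⟨
    maxW (r ++ l)     ∎

  ∈⇒≤maxW : ∀ {a w} → a ∈ w → a ≤ maxW w
  ∈⇒≤maxW {w = b ∷ w} (here refl) = m≤m⊔n b (maxW w)
  ∈⇒≤maxW {w = b ∷ w} (there a∈w) = ≤-trans (∈⇒≤maxW a∈w) (m≤n⊔m b (maxW w))

  maxW-∈ : ∀ w → w ≢ [] → maxW w ∈ w
  maxW-∈ []                w≢[] = contradiction refl w≢[]
  maxW-∈ (a ∷ [])          _    = here (⊔-identityʳ a)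
  maxW-∈ (a ∷ b ∷ w)       _    =
    [ here , (λ a⊔M≡M → there (≡.subst (_∈ b ∷ w) (sym a⊔M≡M) (maxW-∈ (b ∷ w) (λ ())))) ]′
      (⊔-sel a (maxW (b ∷ w)))

  maxW-map : ∀ {f : ℕ → ℕ} → (∀ {a b} → a ≤ b → f a ≤ f b) →
             ∀ w → w ≢ [] → maxW (map f w) ≡ f (maxW w)
  maxW-map         f-mono []           w≢[] = contradiction refl w≢[]
  maxW-map {f}     f-mono (a ∷ [])     _    = ≡.trans (⊔-identityʳ (f a)) (cong f (sym (⊔-identityʳ a)))
  maxW-map {f}     f-mono (a ∷ b ∷ w)  _    =
    ≡.trans (cong (f a ⊔_) (maxW-map f-mono (b ∷ w) λ ())) (sym (mono-≤-distrib-⊔ f-mono a (maxW (b ∷ w))))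

  maxW-++-∉ʳ : ∀ l r → maxW (l ++ r) ∉ r → maxW (l ++ r) ≡ maxW l
  maxW-++-∉ʳ l r M∉r with maxW r ≤? maxW l
  ... | yes r≤l = ≡.trans (maxW-++ l r) (m≥n⇒m⊔n≡m r≤l)
  ... | no  r≰l = contradiction (≡.subst (_∈ r) (sym M≡maxW-r) (maxW-∈ r r≢[])) M∉r
    where
    l<r = ≰⇒> r≰l
    M≡maxW-r = ≡.trans (maxW-++ l r) (m≤n⇒m⊔n≡n (<⇒≤ l<r))
    r≢[] : r ≢ []
    r≢[] refl = n≮0 l<r

  maxW-++-∉ˡ : ∀ l r → maxW (l ++ r) ∉ l → maxW (l ++ r) ≡ maxW r
  maxW-++-∉ˡ l r M∉l =
    ≡.trans (maxW-++-comm l r) (maxW-++-∉ʳ r l (≡.subst (_∉ l) (maxW-++-comm l r) M∉l))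

  -- 0-based, whereas maxPositions is 1-based
  positions : ℕ → Word → List ℕ
  positions m []      = []
  positions m (a ∷ w) = (if a ≡ᵇ m then [ 0 ] else []) ++ map suc (positions m w)

  map-applyUpTo : ∀ (f g : ℕ → ℕ) n → map f (applyUpTo g n) ≡ applyUpTo (f ∘ g) n
  map-applyUpTo f g zero    = refl
  map-applyUpTo f g (suc n) = cong (f (g 0) ∷_) (map-applyUpTo f (g ∘ suc) n)

  zip-applyUpTo-positions : ∀ (f : ℕ → ℕ) m w →
    map proj₁ (filterᵇ (λ p → proj₂ p ≡ᵇ m) (zip (applyUpTo f (length w)) w)) ≡ map f (positions m w)
  zip-applyUpTo-positions f m []      = refl
  zip-applyUpTo-positions f m (a ∷ w) with a ≡ᵇ m
  ... | true  = cong (f 0 ∷_) (≡.trans (zip-applyUpTo-positions (f ∘ suc) m w) (map-∘ (positions m w)))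
  ... | false = ≡.trans (zip-applyUpTo-positions (f ∘ suc) m w) (map-∘ (positions m w))

  maxPositions-positions : ∀ w → maxPositions w ≡ map suc (positions (maxW w) w)
  maxPositions-positions w =
    ≡.trans (cong (λ is → map proj₁ (filterᵇ (λ p → proj₂ p ≡ᵇ maxW w) (zip is w)))
                  (map-applyUpTo suc id (length w)))
            (zip-applyUpTo-positions suc (maxW w) w)

  positions-++ : ∀ m xs ys → positions m (xs ++ ys) ≡ positions m xs ++ map (length xs +_) (positions m ys)
  positions-++ m []       ys = sym (map-id (positions m ys))
  positions-++ m (a ∷ xs) ys = begin
    hd ++ map suc (positions m (xs ++ ys))
      ≡⟨ cong (λ ps → hd ++ map suc ps) (positions-++ m xs ys) ⟩
    hd ++ map suc (positions m xs ++ map (length xs +_) (positions m ys))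
      ≡⟨ cong (hd ++_) (map-++ suc (positions m xs) _) ⟩
    hd ++ (map suc (positions m xs) ++ map suc (map (length xs +_) (positions m ys)))
      ≡⟨ cong (λ ps → hd ++ (map suc (positions m xs) ++ ps)) (map-∘ (positions m ys)) ⟨
    hd ++ (map suc (positions m xs) ++ map (suc (length xs) +_) (positions m ys))
      ≡⟨ ++-assoc hd (map suc (positions m xs)) _ ⟨
    (hd ++ map suc (positions m xs)) ++ map (length (a ∷ xs) +_) (positions m ys) ∎
    where hd = if a ≡ᵇ m then [ 0 ] else []

  positions-∉ : ∀ {m w} → m ∉ w → positions m w ≡ []
  positions-∉ {m} {[]}    _   = refl
  positions-∉ {m} {a ∷ w} m∉ with a ≡ᵇ m | ≡ᵇ-reflects-≡ a m
  ... | true  | ofʸ a≡m = contradiction (here (sym a≡m)) m∉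
  ... | false | _       = cong (map suc) (positions-∉ (m∉ ∘ there))

  positions-∈ : ∀ {m w} → m ∈ w → ∃ (_∈ positions m w)
  positions-∈ {m} {a ∷ w} (here refl) with a ≡ᵇ a | ≡ᵇ-reflects-≡ a a
  ... | true  | _       = 0 , here refl
  ... | false | ofⁿ a≢a = contradiction refl a≢a
  positions-∈ {m} {a ∷ w} (there m∈w) =
    let i , i∈ = positions-∈ m∈w in suc i , ∈-++⁺ʳ _ (∈-map⁺ suc i∈)

  positions-map : ∀ (f : ℕ → ℕ) m w → (∀ {a} → a ∈ w → f a ≡ f m → a ≡ m) →
                  positions (f m) (map f w) ≡ positions m w
  positions-map f m []      _     = refl
  positions-map f m (a ∷ w) f-inj =
    cong₂ (λ b ps → (if b then [ 0 ] else []) ++ map suc ps) same-test (positions-map f m w (f-inj ∘ there))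
    where
    same-test : (f a ≡ᵇ f m) ≡ (a ≡ᵇ m)
    same-test = det (fromEquivalence (f-inj (here refl) ∘ ≡ᵇ⇒≡ (f a) (f m)) (≡⇒≡ᵇ (f a) (f m) ∘ cong f))
                    (≡ᵇ-reflects-≡ a m)

  suc-increasing : ∀ {ps} → Linked _<_ ps → Linked _<_ (map suc ps)
  suc-increasing = map⁺ ∘ Linked.map s<s

  positions-increasing : ∀ m w → Linked _<_ (positions m w)
  positions-increasing m []      = []
  positions-increasing m (a ∷ w) with a ≡ᵇ m | positions m w | positions-increasing m w
  ... | true  | []     | _     = [-]
  ... | true  | _ ∷ _  | ps↑   = z<s ∷ suc-increasing ps↑
  ... | false | _      | ps↑   = suc-increasing ps↑

  suc-ValidIndex : ∀ {i ps} → i ∈ ps → Linked _<_ ps → ValidIndex (map suc ps)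
  suc-ValidIndex {ps = p ∷ ps} _ ps↑ = (λ ()) , positive , suc-increasing ps↑
    where
    positive : ∀ i → i ∈ map suc (p ∷ ps) → 0 < i
    positive i i∈ with ∈-map⁻ suc i∈
    ... | _ , _ , refl = z<s

  maxPositions-ValidIndex : ∀ w → w ≢ [] → ValidIndex (maxPositions w)
  maxPositions-ValidIndex w w≢[] =
    ≡.subst ValidIndex (sym (maxPositions-positions w))
      (suc-ValidIndex (proj₂ (positions-∈ (maxW-∈ w w≢[]))) (positions-increasing (maxW w) w))

  length-filterᵇ-≤ : ∀ {A : Set} {p q : A → Bool} → (∀ x → T (p x) → T (q x)) →
                     ∀ xs → length (filterᵇ p xs) ≤ length (filterᵇ q xs)
  length-filterᵇ-≤         p⇒q []       = z≤n
  length-filterᵇ-≤ {p = p} {q} p⇒q (x ∷ xs) with p x | q x | p⇒q x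
  ... | true  | true  | _   = s≤s (length-filterᵇ-≤ p⇒q xs)
  ... | true  | false | px⇒ = ⊥-elim (px⇒ tt)
  ... | false | true  | _   = m≤n⇒m≤1+n (length-filterᵇ-≤ p⇒q xs)
  ... | false | false | _   = length-filterᵇ-≤ p⇒q xs

  length-filterᵇ-< : ∀ {A : Set} {p q : A → Bool} → (∀ x → T (p x) → T (q x)) →
                     ∀ {y xs} → y ∈ xs → ¬ T (p y) → T (q y) →
                     length (filterᵇ p xs) < length (filterᵇ q xs)
  length-filterᵇ-< {p = p} {q} p⇒q {y} {_ ∷ xs} (here refl) ¬py qy with p y | q y
  ... | true  | _     = contradiction tt ¬py
  ... | false | true  = s≤s (length-filterᵇ-≤ p⇒q xs)
  ... | false | false = ⊥-elim qy
  length-filterᵇ-< {p = p} {q} p⇒q {xs = x ∷ xs} (there y∈) ¬py qy with p x | q x | p⇒q x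
  ... | true  | true  | _   = s≤s (length-filterᵇ-< p⇒q y∈ ¬py qy)
  ... | true  | false | px⇒ = ⊥-elim (px⇒ tt)
  ... | false | true  | _   = m≤n⇒m≤1+n (length-filterᵇ-< p⇒q y∈ ¬py qy)
  ... | false | false | _   = length-filterᵇ-< p⇒q y∈ ¬py qy

  -- pack w is definitionally map (rank w) w
  rank : Word → ℕ → ℕ
  rank w a = length (filterᵇ (_≤ᵇ a) (deduplicateᵇ _≡ᵇ_ w))

  rank-mono : ∀ w {a b} → a ≤ b → rank w a ≤ rank w b
  rank-mono w {a} a≤b =
    length-filterᵇ-≤ (λ x x≤a → ≤⇒≤ᵇ (≤-trans (≤ᵇ⇒≤ x a x≤a) a≤b)) (deduplicateᵇ _≡ᵇ_ w)

  rank-strict : ∀ w {a b} → b ∈ w → a < b → rank w a < rank w b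
  rank-strict w {a} {b} b∈w a<b =
    length-filterᵇ-< (λ x x≤a → ≤⇒≤ᵇ (≤-trans (≤ᵇ⇒≤ x a x≤a) (<⇒≤ a<b))) b∈letters
      (λ b≤a → <⇒≱ a<b (≤ᵇ⇒≤ b a b≤a)) (≤⇒≤ᵇ (≤-refl {b}))
    where
    b∈letters : b ∈ deduplicateᵇ _≡ᵇ_ w
    b∈letters = SetoidMembership.∈-deduplicate⁺ (≡.setoid ℕ) {R = λ x y → T (x ≡ᵇ y)} (T? ∘₂ _≡ᵇ_)
                  (λ {_} {y} {z} z≡ᵇy x≡y → ≡.trans x≡y (sym (≡ᵇ⇒≡ z y z≡ᵇy))) {w} b∈w

  maxPositions-pack : ∀ w → maxPositions (pack w) ≡ maxPositions w
  maxPositions-pack []         = refl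
  maxPositions-pack w@(_ ∷ _) = begin
    maxPositions (map ρ w)                         ≡⟨ maxPositions-positions (map ρ w) ⟩
    map suc (positions (maxW (map ρ w)) (map ρ w)) ≡⟨ cong (λ m → map suc (positions m (map ρ w)))
                                                           (maxW-map (rank-mono w) w λ ()) ⟩
    map suc (positions (ρ M) (map ρ w))            ≡⟨ cong (map suc) (positions-map ρ M w ρ-injective-at-max) ⟩
    map suc (positions M w)                        ≡⟨ maxPositions-positions w ⟨
    maxPositions w                                 ∎
    where
    ρ = rank w
    M = maxW w
    ρ-injective-at-max : ∀ {a} → a ∈ w → ρ a ≡ ρ M → a ≡ M
    ρ-injective-at-max a∈w ρa≡ρM with m≤n⇒m<n∨m≡n (∈⇒≤maxW a∈w)
    ... | inj₁ a<M = contradiction ρa≡ρM (<⇒≢ (rank-strict w (maxW-∈ w λ ()) a<M))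
    ... | inj₂ a≡M = a≡M

  maxPositions-++-∉ʳ : ∀ l r → maxW (l ++ r) ∉ r → maxPositions (l ++ r) ≡ maxPositions l
  maxPositions-++-∉ʳ l r M∉r = begin
    maxPositions (l ++ r)
      ≡⟨ maxPositions-positions (l ++ r) ⟩
    map suc (positions M (l ++ r))
      ≡⟨ cong (map suc) (positions-++ M l r) ⟩
    map suc (positions M l ++ map (length l +_) (positions M r))
      ≡⟨ cong (λ ps → map suc (positions M l ++ map (length l +_) ps)) (positions-∉ M∉r) ⟩
    map suc (positions M l ++ [])
      ≡⟨ cong (map suc) (++-identityʳ (positions M l)) ⟩
    map suc (positions M l)
      ≡⟨ cong (λ m → map suc (positions m l)) (maxW-++-∉ʳ l r M∉r) ⟩
    map suc (positions (maxW l) l)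
      ≡⟨ maxPositions-positions l ⟨
    maxPositions l ∎
    where M = maxW (l ++ r)

  maxPositions-++-∉ˡ : ∀ l r → maxW (l ++ r) ∉ l → maxPositions (l ++ r) ≡ map (length l +_) (maxPositions r)
  maxPositions-++-∉ˡ l r M∉l = begin
    maxPositions (l ++ r)
      ≡⟨ maxPositions-positions (l ++ r) ⟩
    map suc (positions M (l ++ r))
      ≡⟨ cong (map suc) (positions-++ M l r) ⟩
    map suc (positions M l ++ map (length l +_) (positions M r))
      ≡⟨ cong (λ ps → map suc (ps ++ map (length l +_) (positions M r))) (positions-∉ M∉l) ⟩
    map suc (map (length l +_) (positions M r))
      ≡⟨ cong (λ m → map suc (map (length l +_) (positions m r))) (maxW-++-∉ˡ l r M∉l) ⟩
    map suc (map (length l +_) ps)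
      ≡⟨ map-∘ ps ⟨
    map (suc ∘ (length l +_)) ps
      ≡⟨ map-cong (λ j → sym (+-suc (length l) j)) ps ⟩
    map ((length l +_) ∘ suc) ps
      ≡⟨ map-∘ ps ⟩
    map (length l +_) (map suc ps)
      ≡⟨ cong (map (length l +_)) (maxPositions-positions r) ⟨
    map (length l +_) (maxPositions r) ∎
    where
    M  = maxW (l ++ r)
    ps = positions (maxW r) r

module ListSum {c ℓ} (R : Semiring c ℓ) where
  open Semiring R
  open import Algebra.Properties.CommutativeSemigroup +-commutativeSemigroup using (interchange)
  open import Relation.Binary.Reasoning.Setoid setoid

  private
    variable
      a b : Level
      A : Set a
      B : Set b

  ∑ : (A → Carrier) → List A → Carrier
  ∑ f = foldr (λ x s → f x + s) 0#

  ∑-cong : ∀ {f g : A → Carrier} xs → (∀ {x} → x ∈ xs → f x ≈ g x) → ∑ f xs ≈ ∑ g xs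
  ∑-cong []       _   = refl
  ∑-cong (x ∷ xs) f≈g = +-cong (f≈g (here ≡.refl)) (∑-cong xs (f≈g ∘ there))

  ∑-zero : ∀ {f : A → Carrier} xs → (∀ {x} → x ∈ xs → f x ≈ 0#) → ∑ f xs ≈ 0#
  ∑-zero []       _   = refl
  ∑-zero (x ∷ xs) f≈0 = trans (+-cong (f≈0 (here ≡.refl)) (∑-zero xs (f≈0 ∘ there))) (+-identityˡ 0#)

  ∑-++ : ∀ (f : A → Carrier) xs ys → ∑ f (xs ++ ys) ≈ ∑ f xs + ∑ f ys
  ∑-++ f []       ys = sym (+-identityˡ (∑ f ys))
  ∑-++ f (x ∷ xs) ys = trans (+-congˡ (∑-++ f xs ys)) (sym (+-assoc (f x) (∑ f xs) (∑ f ys)))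

  ∑-+ : ∀ (f g : A → Carrier) xs → ∑ (λ x → f x + g x) xs ≈ ∑ f xs + ∑ g xs
  ∑-+ f g []       = sym (+-identityˡ 0#)
  ∑-+ f g (x ∷ xs) = trans (+-congˡ (∑-+ f g xs)) (interchange (f x) (g x) (∑ f xs) (∑ g xs))

  ∑-map : ∀ (f : B → Carrier) (g : A → B) xs → ∑ f (map g xs) ≡ ∑ (f ∘ g) xs
  ∑-map f g = foldr-map _ g 0#

  ∑-concatMap : ∀ (f : B → Carrier) (g : A → List B) xs →
                ∑ f (concatMap g xs) ≈ ∑ (∑ f ∘ g) xs
  ∑-concatMap f g []       = refl
  ∑-concatMap f g (x ∷ xs) = trans (∑-++ f (g x) (concatMap g xs)) (+-congˡ (∑-concatMap f g xs))

  ∑-filterᵇ : ∀ (f : A → Carrier) (p : A → Bool) xs →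
              ∑ f (filterᵇ p xs) ≈ ∑ (λ x → if p x then f x else 0#) xs
  ∑-filterᵇ f p []       = refl
  ∑-filterᵇ f p (x ∷ xs) with p x
  ... | true  = +-congˡ (∑-filterᵇ f p xs)
  ... | false = trans (∑-filterᵇ f p xs) (sym (+-identityˡ _))

  *-distribˡ-∑ : ∀ c (f : A → Carrier) xs → c * ∑ f xs ≈ ∑ (λ x → c * f x) xs
  *-distribˡ-∑ c f []       = zeroʳ c
  *-distribˡ-∑ c f (x ∷ xs) = trans (distribˡ c (f x) (∑ f xs)) (+-congˡ (*-distribˡ-∑ c f xs))

  *-distribʳ-∑ : ∀ c (f : A → Carrier) xs → ∑ f xs * c ≈ ∑ (λ x → f x * c) xs
  *-distribʳ-∑ c f []       = zeroˡ c
  *-distribʳ-∑ c f (x ∷ xs) = trans (distribʳ c (f x) (∑ f xs)) (+-congˡ (*-distribʳ-∑ c f xs))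

  ∑-swap : ∀ (f : A → B → Carrier) xs ys →
           ∑ (λ x → ∑ (f x) ys) xs ≈ ∑ (λ y → ∑ (λ x → f x y) xs) ys
  ∑-swap f []       ys = sym (∑-zero ys (λ _ → refl))
  ∑-swap f (x ∷ xs) ys = begin
    ∑ (f x) ys + ∑ (λ x → ∑ (f x) ys) xs        ≈⟨ +-congˡ (∑-swap f xs ys) ⟩
    ∑ (f x) ys + ∑ (λ y → ∑ (λ x → f x y) xs) ys ≈⟨ ∑-+ (f x) (λ y → ∑ (λ x → f x y) xs) ys ⟨
    ∑ (λ y → f x y + ∑ (λ x → f x y) xs) ys      ∎

  ∑-concentrated-by : ∀ (key : A → B) (f : A → Carrier) xs {x₀} →
                      Unique (map key xs) → x₀ ∈ xs →
                      (∀ {x} → x ∈ xs → key x ≢ key x₀ → f x ≈ 0#) → ∑ f xs ≈ f x₀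
  ∑-concentrated-by key f (x ∷ xs) (keyx∉ ∷ _) (here ≡.refl) f≈0 =
    trans (+-congˡ (∑-zero xs λ x∈ → f≈0 (there x∈) λ e → All.lookup keyx∉ (∈-map⁺ key x∈) (≡.sym e)))
          (+-identityʳ (f x))
  ∑-concentrated-by key f (x ∷ xs) (keyx∉ ∷ unique) (there x₀∈) f≈0 =
    trans (+-congʳ (f≈0 (here ≡.refl) (All.lookup keyx∉ (∈-map⁺ key x₀∈))))
          (trans (+-identityˡ _) (∑-concentrated-by key f xs unique x₀∈ (f≈0 ∘ there)))

  ∑-concentrated : ∀ (f : A → Carrier) xs {x₀} → Unique xs → x₀ ∈ xs →
                   (∀ {x} → x ∈ xs → x ≢ x₀ → f x ≈ 0#) → ∑ f xs ≈ f x₀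
  ∑-concentrated f xs unique = ∑-concentrated-by id f xs (≡.subst Unique (≡.sym (map-id xs)) unique)

_≟ᵂ_ : DecidableEquality Word
_≟ᵂ_ = ≡-dec ℕ._≟_

module TotallyPrimitive {c ℓ} (K : Field c ℓ) where
  open Field K
  open WQSym K
  open ListSum semiring
  open MaxPositions
  open import Data.List.Membership.DecPropositional _≟ᵂ_ using (_∈?_)
  open import Relation.Binary.Reasoning.Setoid setoid

  word : Carrier × PW⁺ → Word
  word = proj₁ ∘ proj₂

  indicator : Bool → Carrier
  indicator b = if b then 1# else 0#

  if-then-0#≈*indicator : ∀ b x → (if b then x else 0#) ≈ x * indicator b
  if-then-0#≈*indicator true  x = sym (*-identityʳ x)
  if-then-0#≈*indicator false x = sym (zeroʳ x)

  -- coeff x w is definitionally ∑ (termCoeff w) x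
  termCoeff : Word → Carrier × PW⁺ → Carrier
  termCoeff w t = if word t ==ᵂ w then proj₁ t else 0#

  termCoeff-self : ∀ t → termCoeff (word t) t ≈ proj₁ t
  termCoeff-self t with word t ≟ᵂ word t
  ... | yes _  = refl
  ... | no  ne = contradiction ≡.refl ne

  termCoeff-other : ∀ {w} t → word t ≢ w → termCoeff w t ≈ 0#
  termCoeff-other {w} t ne with word t ≟ᵂ w
  ... | yes e = contradiction e ne
  ... | no  _ = refl

  ⟪_⟫ : (Word → Carrier) → WQ₊ → Carrier
  ⟪ h ⟫ = ∑ (λ t → proj₁ t * h (word t))

  ⟪⟫-via-coeff : ∀ h x ws → Unique ws → (∀ {t} → t ∈ x → word t ∈ ws) →
                 ⟪ h ⟫ x ≈ ∑ (λ w → coeff x w * h w) ws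
  ⟪⟫-via-coeff h x ws ws-unique covered = begin
    ∑ (λ t → proj₁ t * h (word t)) x
      ≈⟨ ∑-cong x (λ {t} → sym ∘ only-word-t t) ⟩
    ∑ (λ t → ∑ (λ w → termCoeff w t * h w) ws) x
      ≈⟨ ∑-swap (λ t w → termCoeff w t * h w) x ws ⟩
    ∑ (λ w → ∑ (λ t → termCoeff w t * h w) x) ws
      ≈⟨ ∑-cong ws (λ {w} _ → *-distribʳ-∑ (h w) (termCoeff w) x) ⟨
    ∑ (λ w → coeff x w * h w) ws ∎
    where
    only-word-t : ∀ t → t ∈ x → ∑ (λ w → termCoeff w t * h w) ws ≈ proj₁ t * h (word t)
    only-word-t t t∈ =
      trans (∑-concentrated (λ w → termCoeff w t * h w) ws ws-unique (covered t∈)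
               (λ {w} _ w≢word → trans (*-congʳ (termCoeff-other t (w≢word ∘ ≡.sym))) (zeroˡ (h w))))
            (*-congʳ (termCoeff-self t))

  ⟪⟫-resp-≋ : ∀ h {x y} → x ≋ y → ⟪ h ⟫ x ≈ ⟪ h ⟫ y
  ⟪⟫-resp-≋ h {x} {y} x≋y = begin
    ⟪ h ⟫ x                        ≈⟨ ⟪⟫-via-coeff h x ws ws-unique (∈-deduplicate⁺ _≟ᵂ_ ∘ ∈-++⁺ˡ ∘ ∈-map⁺ word) ⟩
    ∑ (λ w → coeff x w * h w) ws   ≈⟨ ∑-cong ws (λ {w} _ → *-congʳ (x≋y w)) ⟩
    ∑ (λ w → coeff y w * h w) ws   ≈⟨ ⟪⟫-via-coeff h y ws ws-unique (∈-deduplicate⁺ _≟ᵂ_ ∘ ∈-++⁺ʳ _ ∘ ∈-map⁺ word) ⟨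
    ⟪ h ⟫ y                        ∎
    where
    ws = deduplicate _≟ᵂ_ (map word x ++ map word y)
    ws-unique = deduplicate-! _≟ᵂ_ (map word x ++ map word y)

  ∑-τ-supported : ∀ (f : Carrier × PW⁺ → Carrier) I x →
                  (∀ t → maxPositions (word t) ≢ I → f t ≈ 0#) → ∑ f (τ I x) ≈ ∑ f x
  ∑-τ-supported f I x f-supported = trans (∑-filterᵇ f _ x) (∑-cong x λ {t} _ → kept t)
    where
    kept : ∀ t → (if maxPositions (word t) ==ᵂ I then f t else 0#) ≈ f t
    kept t with maxPositions (word t) ≟ᵂ I
    ... | yes _  = refl
    ... | no  ne = sym (f-supported t ne)

  ∑-τ-outside : ∀ (f : Carrier × PW⁺ → Carrier) I x →
                (∀ t → maxPositions (word t) ≡ I → f t ≈ 0#) → ∑ f (τ I x) ≈ 0#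
  ∑-τ-outside f I x f-outside = trans (∑-filterᵇ f _ x) (∑-zero x λ {t} _ → dropped t)
    where
    dropped : ∀ t → (if maxPositions (word t) ==ᵂ I then f t else 0#) ≈ 0#
    dropped t with maxPositions (word t) ≟ᵂ I
    ... | yes e = f-outside t e
    ... | no  _ = refl

  coeff-τ-≡ : ∀ {I} w → maxPositions w ≡ I → ∀ x → coeff (τ I x) w ≈ coeff x w
  coeff-τ-≡ {I} w mp≡I x =
    ∑-τ-supported (termCoeff w) I x (λ t ne → termCoeff-other t (λ { ≡.refl → ne mp≡I }))

  coeff-τ-≢ : ∀ {I} w → maxPositions w ≢ I → ∀ x → coeff (τ I x) w ≈ 0#
  coeff-τ-≢ {I} w mp≢I x =
    ∑-τ-outside (termCoeff w) I x (λ t e → termCoeff-other t (λ { ≡.refl → mp≢I e }))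

  cutTerms : (Word → List (Word × Word)) → Carrier × PW⁺ → WQ₊⊗WQ₊
  cutTerms cutsOf t = map (λ lr → proj₁ t , pack (proj₁ lr) , pack (proj₂ lr)) (cutsOf (word t))

  halfCoproduct : (Word → List (Word × Word)) → WQ₊ → WQ₊⊗WQ₊
  halfCoproduct cutsOf = concatMap (cutTerms cutsOf)

  -- coeff₂ d a b is definitionally ∑ (tensorCoeff a b) d
  tensorCoeff : Word → Word → Carrier × Word × Word → Carrier
  tensorCoeff a b (x , u , v) = if (u ==ᵂ a) ∧ (v ==ᵂ b) then x else 0#

  cutMultiplicity : (Word → List (Word × Word)) → Word → Word → Word → Carrier
  cutMultiplicity cutsOf a b w =
    ∑ (λ lr → indicator ((pack (proj₁ lr) ==ᵂ a) ∧ (pack (proj₂ lr) ==ᵂ b))) (cutsOf w)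

  coeff₂-halfCoproduct : ∀ cutsOf x a b →
                         coeff₂ (halfCoproduct cutsOf x) a b ≈ ⟪ cutMultiplicity cutsOf a b ⟫ x
  coeff₂-halfCoproduct cutsOf x a b =
    trans (∑-concatMap (tensorCoeff a b) (cutTerms cutsOf) x) (∑-cong x λ {t} _ → term t)
    where
    term : ∀ t → ∑ (tensorCoeff a b) (cutTerms cutsOf t) ≈ proj₁ t * cutMultiplicity cutsOf a b (word t)
    term t = begin
      ∑ (tensorCoeff a b) (cutTerms cutsOf t)
        ≡⟨ ∑-map (tensorCoeff a b) _ (cutsOf (word t)) ⟩
      ∑ (λ lr → if (pack (proj₁ lr) ==ᵂ a) ∧ (pack (proj₂ lr) ==ᵂ b) then proj₁ t else 0#) (cutsOf (word t))
        ≈⟨ ∑-cong (cutsOf (word t)) (λ _ → if-then-0#≈*indicator _ (proj₁ t)) ⟩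
      ∑ (λ lr → proj₁ t * indicator ((pack (proj₁ lr) ==ᵂ a) ∧ (pack (proj₂ lr) ==ᵂ b))) (cutsOf (word t))
        ≈⟨ *-distribˡ-∑ (proj₁ t) _ (cutsOf (word t)) ⟨
      proj₁ t * cutMultiplicity cutsOf a b (word t) ∎

  MaxPositionsKeyedBy : (Word → List (Word × Word)) → (Word → Word → List ℕ) → Set
  MaxPositionsKeyedBy cutsOf key =
    ∀ w {lr} → lr ∈ cutsOf w → maxPositions w ≡ key (pack (proj₁ lr)) (pack (proj₂ lr))

  module _ (cutsOf : Word → List (Word × Word)) (key : Word → Word → List ℕ)
           (keyed : MaxPositionsKeyedBy cutsOf key) where

    cutMultiplicity-off-key : ∀ {a b} w → maxPositions w ≢ key a b → cutMultiplicity cutsOf a b w ≈ 0#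
    cutMultiplicity-off-key {a} {b} w off = ∑-zero (cutsOf w) term
      where
      term : ∀ {lr} → lr ∈ cutsOf w → indicator ((pack (proj₁ lr) ==ᵂ a) ∧ (pack (proj₂ lr) ==ᵂ b)) ≈ 0#
      term {lr} lr∈ with pack (proj₁ lr) ≟ᵂ a | pack (proj₂ lr) ≟ᵂ b
      ... | yes ≡.refl | yes ≡.refl = contradiction (keyed w lr∈) off
      ... | yes _      | no  _      = refl
      ... | no  _      | _          = refl

    weighted-off-key : ∀ {a b} t → maxPositions (word t) ≢ key a b →
                       proj₁ t * cutMultiplicity cutsOf a b (word t) ≈ 0#
    weighted-off-key t off = trans (*-congˡ (cutMultiplicity-off-key (word t) off)) (zeroʳ (proj₁ t))

    halfCoproduct-τ : ∀ I x → IsZero₂ (halfCoproduct cutsOf x) → IsZero₂ (halfCoproduct cutsOf (τ I x))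
    halfCoproduct-τ I x Δx≈0 a b with key a b ≟ᵂ I
    ... | yes ≡.refl = begin
      coeff₂ (halfCoproduct cutsOf (τ I x)) a b
        ≈⟨ coeff₂-halfCoproduct cutsOf (τ I x) a b ⟩
      ⟪ cutMultiplicity cutsOf a b ⟫ (τ I x)
        ≈⟨ ∑-τ-supported _ I x weighted-off-key ⟩
      ⟪ cutMultiplicity cutsOf a b ⟫ x
        ≈⟨ coeff₂-halfCoproduct cutsOf x a b ⟨
      coeff₂ (halfCoproduct cutsOf x) a b
        ≈⟨ Δx≈0 a b ⟩
      0# ∎
    ... | no key≢I = trans (coeff₂-halfCoproduct cutsOf (τ I x) a b)
      (∑-τ-outside _ I x λ t mp≡I → weighted-off-key t λ mp≡key → key≢I (≡.trans (≡.sym mp≡key) mp≡I))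

  halfCoproduct-resp-≋ : ∀ cutsOf {x y} → x ≋ y →
                         IsZero₂ (halfCoproduct cutsOf x) → IsZero₂ (halfCoproduct cutsOf y)
  halfCoproduct-resp-≋ cutsOf {x} {y} x≋y Δx≈0 a b = begin
    coeff₂ (halfCoproduct cutsOf y) a b   ≈⟨ coeff₂-halfCoproduct cutsOf y a b ⟩
    ⟪ cutMultiplicity cutsOf a b ⟫ y      ≈⟨ ⟪⟫-resp-≋ (cutMultiplicity cutsOf a b) {x} {y} x≋y ⟨
    ⟪ cutMultiplicity cutsOf a b ⟫ x      ≈⟨ coeff₂-halfCoproduct cutsOf x a b ⟨
    coeff₂ (halfCoproduct cutsOf x) a b   ≈⟨ Δx≈0 a b ⟩
    0#                                    ∎

  -- Δ≺ and Δ≻ are definitionally halfCoproduct leftCuts and halfCoproduct rightCuts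
  leftCuts rightCuts : Word → List (Word × Word)
  leftCuts  w = filterᵇ (λ lr → disjointᵇ (proj₁ lr) (proj₂ lr) ∧ not (maxW w ∈ᵇ proj₂ lr)) (cuts w)
  rightCuts w = filterᵇ (λ lr → disjointᵇ (proj₁ lr) (proj₂ lr) ∧ not (maxW w ∈ᵇ proj₁ lr)) (cuts w)

  ∈-cuts : ∀ {w lr} → lr ∈ cuts w → proj₁ lr ++ proj₂ lr ≡ w
  ∈-cuts {w} lr∈ with ∈-map⁻ _ lr∈
  ... | i , _ , ≡.refl = take++drop≡id i w

  ∉-from-∈ᵇ : ∀ {m w} → T (not (m ∈ᵇ w)) → m ∉ w
  ∉-from-∈ᵇ {m} m∉ᵇw m∈w =
    ≡.subst T (Equivalence.to T-not-≡ m∉ᵇw) (any⁺ (m ≡ᵇ_) (Any.map (ℕ.≡⇒≡ᵇ m _) m∈w))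

  ∈-cutsAvoidingMax : ∀ (side : Word × Word → Word) {w lr} →
    lr ∈ filterᵇ (λ lr → disjointᵇ (proj₁ lr) (proj₂ lr) ∧ not (maxW w ∈ᵇ side lr)) (cuts w) →
    proj₁ lr ++ proj₂ lr ≡ w × maxW w ∉ side lr
  ∈-cutsAvoidingMax side lr∈ with ∈-filter⁻ (T? ∘ _) lr∈
  ... | lr∈cuts , admissible = ∈-cuts lr∈cuts , ∉-from-∈ᵇ (proj₂ (Equivalence.to T-∧ admissible))

  leftKey rightKey : Word → Word → List ℕ
  leftKey  u _ = maxPositions u
  rightKey u v = map (length u ℕ+_) (maxPositions v)

  leftCuts-keyed : MaxPositionsKeyedBy leftCuts leftKey
  leftCuts-keyed w {l , r} lr∈ with ∈-cutsAvoidingMax proj₂ {w} lr∈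
  ... | ≡.refl , M∉r = ≡.trans (maxPositions-++-∉ʳ l r M∉r) (≡.sym (maxPositions-pack l))

  rightCuts-keyed : MaxPositionsKeyedBy rightCuts rightKey
  rightCuts-keyed w {l , r} lr∈ with ∈-cutsAvoidingMax proj₁ {w} lr∈
  ... | ≡.refl , M∉l =
    ≡.trans (maxPositions-++-∉ˡ l r M∉l)
            (≡.cong₂ (λ n ps → map (n ℕ+_) ps) (≡.sym (length-map _ l)) (≡.sym (maxPositions-pack r)))

  TPrim-τ : ∀ I x → TPrim x → TPrim (τ I x)
  TPrim-τ I x (Δ≺x≈0 , Δ≻x≈0) = halfCoproduct-τ leftCuts leftKey leftCuts-keyed I x Δ≺x≈0 ,
    halfCoproduct-τ rightCuts rightKey rightCuts-keyed I x Δ≻x≈0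

  TPrim-resp-≋ : ∀ {x y} → x ≋ y → TPrim x → TPrim y
  TPrim-resp-≋ {x} {y} x≋y (Δ≺x≈0 , Δ≻x≈0) =
    halfCoproduct-resp-≋ leftCuts {x} {y} x≋y Δ≺x≈0 , halfCoproduct-resp-≋ rightCuts {x} {y} x≋y Δ≻x≈0

  coeff-image-≢ : ∀ {I} y → InIm I y → ∀ w → maxPositions w ≢ I → coeff y w ≈ 0#
  coeff-image-≢ y (x , τx≋y) w mp≢I = trans (sym (τx≋y w)) (coeff-τ-≢ w mp≢I x)

  τ-image : ∀ {I} y → InIm I y → τ I y ≋ y
  τ-image {I} y y∈Im w with maxPositions w ≟ᵂ I
  ... | yes mp≡I = coeff-τ-≡ w mp≡I y
  ... | no  mp≢I = trans (coeff-τ-≢ w mp≢I y) (sym (coeff-image-≢ y y∈Im w mp≢I))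

  τ-TPrim⇔Im∩TPrim : ∀ I y → (Σ WQ₊ λ x → TPrim x × τ I x ≋ y) ⇔ (InIm I y × TPrim y)
  τ-TPrim⇔Im∩TPrim I y = mk⇔
    (λ (x , x-TPrim , τx≋y) → (x , τx≋y) , TPrim-resp-≋ {τ I x} {y} τx≋y (TPrim-τ I x x-TPrim))
    (λ (y∈Im , y-TPrim) → y , y-TPrim , τ-image y y∈Im)

  coeff-sumᵂ : ∀ ys w → coeff (sumᵂ ys) w ≈ ∑ (λ y → coeff y w) ys
  coeff-sumᵂ []       w = refl
  coeff-sumᵂ (y ∷ ys) w = trans (∑-++ (termCoeff w) y (sumᵂ ys)) (+-congˡ (coeff-sumᵂ ys w))

  τ-partition : ∀ x Is → Unique Is → (∀ {t} → t ∈ x → maxPositions (word t) ∈ Is) →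
                x ≋ sumᵂ (map (λ I → τ I x) Is)
  τ-partition x Is Is-unique covered w = sym (begin
    coeff (sumᵂ (map (λ I → τ I x) Is)) w    ≈⟨ coeff-sumᵂ (map (λ I → τ I x) Is) w ⟩
    ∑ (λ y → coeff y w) (map (λ I → τ I x) Is) ≡⟨ ∑-map (λ y → coeff y w) (λ I → τ I x) Is ⟩
    ∑ (λ I → coeff (τ I x) w) Is             ≈⟨ by-membership (maxPositions w ∈? Is) ⟩
    coeff x w                                ∎)
    where
    by-membership : Dec (maxPositions w ∈ Is) → ∑ (λ I → coeff (τ I x) w) Is ≈ coeff x w
    by-membership (yes mp∈) =
      trans (∑-concentrated (λ I → coeff (τ I x) w) Is Is-unique mp∈
                            (λ _ I≢mp → coeff-τ-≢ w (I≢mp ∘ ≡.sym) x))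
            (coeff-τ-≡ w ≡.refl x)
    by-membership (no mp∉) =
      trans (∑-zero Is (λ I∈ → coeff-τ-≢ w (λ { ≡.refl → mp∉ I∈ }) x))
            (sym (∑-zero x (λ {t} t∈ → termCoeff-other t (λ { ≡.refl → mp∉ (covered t∈) }))))

  IsComponent : List ℕ × WQ₊ → Set (c Level.⊔ ℓ)
  IsComponent p = ValidIndex (proj₁ p) × InIm (proj₁ p) (proj₂ p) × TPrim (proj₂ p)

  TPrim-decomposition : ∀ x → TPrim x →
    Σ (List (List ℕ × WQ₊)) λ L → All IsComponent L × Unique (map proj₁ L) × x ≋ sumᵂ (map proj₂ L)
  TPrim-decomposition x x-TPrim =
    map component Is , Allₚ.map⁺ (All.tabulate is-component) , keys-unique , x≋sum
    where
    Is = deduplicate _≟ᵂ_ (map (maxPositions ∘ word) x)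
    Is-unique = deduplicate-! _≟ᵂ_ (map (maxPositions ∘ word) x)
    component : List ℕ → List ℕ × WQ₊
    component I = I , τ I x
    is-component : ∀ {I} → I ∈ Is → IsComponent (component I)
    is-component I∈ with ∈-map⁻ (maxPositions ∘ word) (∈-deduplicate⁻ _≟ᵂ_ _ I∈)
    ... | t , _ , ≡.refl =
      maxPositions-ValidIndex (word t) (proj₂ (proj₂ (proj₂ t))) , (x , λ _ → refl) , TPrim-τ _ x x-TPrim
    keys-unique : Unique (map proj₁ (map component Is))
    keys-unique = ≡.subst Unique (≡.trans (≡.sym (map-id Is)) (map-∘ Is)) Is-unique
    x≋sum : x ≋ sumᵂ (map proj₂ (map component Is))
    x≋sum = ≡.subst (λ ys → x ≋ sumᵂ ys) (map-∘ Is)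
              (τ-partition x Is Is-unique (λ t∈ → ∈-deduplicate⁺ _≟ᵂ_ (∈-map⁺ (maxPositions ∘ word) t∈)))

  components-independent : ∀ L → All IsComponent L → Unique (map proj₁ L) →
                           sumᵂ (map proj₂ L) ≋ 0ᵂ → All (λ p → proj₂ p ≋ 0ᵂ) L
  components-independent L components keys-unique sum≋0 =
    All.tabulate λ {p₀} p₀∈ w → vanishes p₀∈ w (maxPositions w ≟ᵂ proj₁ p₀)
    where
    inIm : ∀ {p} → p ∈ L → InIm (proj₁ p) (proj₂ p)
    inIm p∈ = proj₁ (proj₂ (All.lookup components p∈))
    vanishes : ∀ {p₀} → p₀ ∈ L → ∀ w → Dec (maxPositions w ≡ proj₁ p₀) → coeff (proj₂ p₀) w ≈ 0#
    vanishes {p₀} p₀∈ w (no mp≢I₀) = coeff-image-≢ (proj₂ p₀) (inIm p₀∈) w mp≢I₀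
    vanishes {p₀} p₀∈ w (yes mp≡I₀) = begin
      coeff (proj₂ p₀) w
        ≈⟨ ∑-concentrated-by proj₁ (λ p → coeff (proj₂ p) w) L keys-unique p₀∈
             (λ {p} p∈ I≢I₀ → coeff-image-≢ (proj₂ p) (inIm p∈) w λ mp≡I → I≢I₀ (≡.trans (≡.sym mp≡I) mp≡I₀)) ⟨
      ∑ (λ p → coeff (proj₂ p) w) L         ≡⟨ ∑-map (λ y → coeff y w) proj₂ L ⟨
      ∑ (λ y → coeff y w) (map proj₂ L)     ≈⟨ coeff-sumᵂ (map proj₂ L) w ⟨
      coeff (sumᵂ (map proj₂ L)) w          ≈⟨ sum≋0 w ⟩
      0#                                    ∎

lemma3p4 : ∀ {c ℓ : Level} (K : Field c ℓ) → let open WQSym K in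
    (∀ (I : List ℕ) → ValidIndex I → ∀ x → TPrim x → TPrim (τ I x))
  × (∀ (I : List ℕ) → ValidIndex I → ∀ y →
       (Σ WQ₊ λ x → TPrim x × τ I x ≋ y) ⇔ (InIm I y × TPrim y))
  × (∀ x → TPrim x →
       Σ (List (List ℕ × WQ₊)) λ L →
         All (λ p → ValidIndex (proj₁ p) × InIm (proj₁ p) (proj₂ p) × TPrim (proj₂ p)) L
         × Unique (map proj₁ L)
         × x ≋ sumᵂ (map proj₂ L))
  × (∀ (L : List (List ℕ × WQ₊)) →
       All (λ p → ValidIndex (proj₁ p) × InIm (proj₁ p) (proj₂ p) × TPrim (proj₂ p)) L →
       Unique (map proj₁ L) →
       sumᵂ (map proj₂ L) ≋ 0ᵂ →
       All (λ p → proj₂ p ≋ 0ᵂ) L)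
lemma3p4 K =
  (λ I _ → TPrim-τ I) , (λ I _ → τ-TPrim⇔Im∩TPrim I) , TPrim-decomposition , components-independent
  where open TotallyPrimitive K
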